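{- Let $n \geq 1$, let $\Pi \subseteq S_n$ be admissible and shift restricted, let $m > n$, and let $\Gamma_n$ be the alphabet fixing subgraph of $G_m = G_m(\Pi)$. Suppose that for all vertices $u, v$ of $\Gamma_n$ with $u \to v$, either there is more than one directed walk of length $n$ from $v$ to $u$, or there is a directed walk of length less than $n$ from $v$ to $u$. Then $G_m$ is alphabet stable.
   Context: Word graphs: for $\Pi \subseteq S_n$, $m > n$ and a set $B$ with $|B| = m$, the word graph $G_m = G_m(\Pi)$ is the directed graph whose vertices are the words $x_1 \dots x_n$ over $B$ with pairwise distinct letters, with arcs $x_1 x_2 \dots x_n \to x_2 \dots x_n y$ for every $y \in B\setminus\{x_1,\dots,x_n\}$ and $x_1 \dots x_n \to x_{\pi(1)} \dots x_{\pi(n)}$ for every $\pi \in \Pi$. $\Pi$ is admissible if the directed diameter of $G_{4n}(\Pi)$ equals $n$; $\Pi$ is shift restricted if $\pi(i) \leq i+1$ for all $\pi \in \Pi$, $1 \leq i \leq n$. The alphabet of $v = x_1\dots x_n$ is $\alpha(v) = \{x_1,\dots,x_n\}$. The alphabet fixing subgraph $\Gamma_n$ is the subgraph of $G_m$ induced by the words over a fixed $n$-element subset $A \subseteq B$. $G_m$ is alphabet stable if there is no automorphism $\phi$ of $G_m$ and vertices $u, v$ with $\alpha(u) = \alpha(v)$ but $\alpha(\phi(u)) \neq \alpha(\phi(v))$. -}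

module Defs where

open import Data.Nat using (ℕ; zero; suc; _+_; _*_; _≤_; _<_)
open import Data.Fin using (Fin; toℕ)
open import Data.Fin.Permutation using (Permutation′; _⟨$⟩ʳ_)
open import Data.Fin.Subset using (Subset; ∣_∣) renaming (_∈_ to _∈ₛ_)
open import Data.Vec using (Vec; []; _∷_; _∷ʳ_; lookup; tabulate; head; last)
open import Data.Vec.Membership.Propositional using (_∈_; _∉_)
open import Data.Vec.Relation.Unary.All using (All)
open import Data.Product using (Σ; ∃; ∃-syntax; _×_; _,_)
open import Data.Sum using (_⊎_)
open import Data.Unit using (⊤)
open import Function.Definitions using (Injective)
open import Function.Bundles using (_⇔_)
open import Relation.Nullary using (¬_)
open import Relation.Binary.PropositionalEquality using (_≡_; _≢_)

PermSet : ℕ → Set₁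
PermSet n = Permutation′ n → Set

Word : ℕ → ℕ → Set
Word m n = Vec (Fin m) n

IsVertex : ∀ {m n} → Word m n → Set
IsVertex w = Injective _≡_ _≡_ (lookup w)

SameAlphabet : ∀ {m n} → Word m n → Word m n → Set
SameAlphabet u v = ∀ x → (x ∈ u) ⇔ (x ∈ v)

shift : ∀ {A : Set} {n} → Vec A n → A → Vec A n
shift []       y = []
shift (x ∷ xs) y = xs ∷ʳ y

permute : ∀ {A : Set} {n} → Permutation′ n → Vec A n → Vec A n
permute π w = tabulate (λ i → lookup w (π ⟨$⟩ʳ i))

Arc : ∀ {n} (Π : PermSet n) (m : ℕ) → Word m n → Word m n → Set
Arc Π m u v =
  IsVertex u × IsVertex v ×
  ((Σ (Fin m) λ y → y ∉ u × v ≡ shift u y)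
   ⊎ (Σ (Permutation′ _) λ π → Π π × v ≡ permute π u))

Chain : ∀ {A : Set} (R : A → A → Set) {k} → Vec A (suc k) → Set
Chain R {zero}  (x ∷ [])     = ⊤
Chain R {suc k} (x ∷ y ∷ xs) = R x y × Chain R (y ∷ xs)

IsWalk : ∀ {A : Set} (V : A → Set) (R : A → A → Set) (k : ℕ) → A → A → Vec A (suc k) → Set
IsWalk V R k u v s = head s ≡ u × last s ≡ v × All V s × Chain R s

Walk : ∀ {A : Set} (V : A → Set) (R : A → A → Set) (k : ℕ) → A → A → Set
Walk V R k u v = Σ (Vec _ (suc k)) (IsWalk V R k u v)

DiameterEq : ∀ {n} (Π : PermSet n) (m d : ℕ) → Set
DiameterEq {n} Π m d =
  (∀ (u v : Word m n) → IsVertex u → IsVertex v →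
     Σ ℕ λ k → k ≤ d × Walk IsVertex (Arc Π m) k u v)
  × (Σ (Word m n) λ u → Σ (Word m n) λ v → IsVertex u × IsVertex v ×
       (∀ k → k < d → ¬ Walk IsVertex (Arc Π m) k u v))

Admissible : ∀ {n} → PermSet n → Set
Admissible {n} Π = DiameterEq Π (4 * n) n

-- π(i) ≤ i+1 (equivalent in 0-indexed form)
ShiftRestricted : ∀ {n} → PermSet n → Set
ShiftRestricted {n} Π = ∀ π → Π π → ∀ (i : Fin n) → toℕ (π ⟨$⟩ʳ i) ≤ suc (toℕ i)

-- Alphabet fixing subgraph Γ_n for a fixed A ⊆ B (|A| = n): induced on words over A.
InΓ : ∀ {m n} → Subset m → Word m n → Set
InΓ A w = IsVertex w × All (_∈ₛ A) w

ArcΓ : ∀ {n} (Π : PermSet n) (m : ℕ) → Subset m → Word m n → Word m n → Set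
ArcΓ Π m A u v = InΓ A u × InΓ A v × Arc Π m u v

IsAutomorphism : ∀ {n} (Π : PermSet n) (m : ℕ) → (Word m n → Word m n) → Set
IsAutomorphism {n} Π m φ =
  (∀ u → IsVertex u → IsVertex (φ u))
  × (∀ u v → IsVertex u → IsVertex v → φ u ≡ φ v → u ≡ v)
  × (∀ v → IsVertex v → Σ (Word m n) λ u → IsVertex u × φ u ≡ v)
  × (∀ u v → IsVertex u → IsVertex v → Arc Π m u v ⇔ Arc Π m (φ u) (φ v))

AlphabetStable : ∀ {n} (Π : PermSet n) (m : ℕ) → Set
AlphabetStable {n} Π m =
  ¬ (Σ (Word m n → Word m n) λ φ → IsAutomorphism Π m φ ×
      Σ (Word m n) λ u → Σ (Word m n) λ v →
        IsVertex u × IsVertex v × SameAlphabet u v × ¬ SameAlphabet (φ u) (φ v))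

WalkHypothesis : ∀ {n} (Π : PermSet n) (m : ℕ) → Subset m → Set
WalkHypothesis {n} Π m A =
  ∀ (u v : Word m n) → InΓ A u → InΓ A v → ArcΓ Π m A u v →
    (Σ (Vec (Word m n) (suc n)) λ s → Σ (Vec (Word m n) (suc n)) λ t →
        IsWalk (InΓ A) (ArcΓ Π m A) n v u s × IsWalk (InΓ A) (ArcΓ Π m A) n v u t × s ≢ t)
    ⊎ (Σ ℕ λ k → k < n × Walk (InΓ A) (ArcΓ Π m A) k v u)

module Submission where

-- Write N = n + 1 for the word length.  Since Π is shift restricted, every arc moves each letter
--    at most one position to the left, and a shift arc inserts its new letter
--    at the last position.  Consequently a shift arc  u → shift u y  admits no
--    walk of length < N back to u, and exactly one walk of length N: the one
--    that re-inserts the letters of u in order (`shift-noReturn`).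
--  * Permutation arcs do return.  Relabelling the letters of A onto those of a
--    vertex a transports the hypothesis on Γ_n to every permutation arc
--    a → π a of G_m (`permArc-returns`).  As automorphisms preserve walks, an
--    automorphism maps a permutation arc to a permutation arc, hence keeps the
--    alphabet constant along it (`automorphism-permArc`).
--  * Connectivity.  Admissibility gives walks of length ≤ N in G_{4N}; a walk
--    of that length which brings in no new letter consists of permutation arcs
--    only.  Reading such a walk through a vertex u shows that any two vertices
--    of G_m with the same alphabet are joined by permutation arcs
--    (`sameAlphabet⇒permReach`).
-- The theorem follows by composing the last two facts along that path.

open import Defs
open import Data.Nat using (ℕ; zero; suc; _+_; _*_; _≤_; _<_; z≤n; s≤s)
open import Data.Nat.Properties
  using (≤-refl; ≤-trans; ≤-reflexive; ≤-<-trans; <⇒≤; ≤-pred; n≮n; m≤n⇒m≤1+n; m<m+n; m+1+n≰m;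
         +-comm; +-suc; +-identityʳ; 1+n≢n)
open import Data.Bool using (true; false)
open import Data.Fin using (Fin; zero; suc; toℕ; fromℕ; fromℕ<; inject₁; _↑ˡ_)
open import Data.Fin.Properties
  using (toℕ-injective; toℕ<n; toℕ-fromℕ; toℕ-fromℕ<; toℕ-inject₁; ↑ˡ-injective; suc-injective; _≟_)
open import Data.Fin.Relation.Unary.Top using (view; ‵fromℕ; ‵inject₁)
open import Data.Fin.Permutation using (Permutation′; _⟨$⟩ʳ_; _⟨$⟩ˡ_; inverseʳ; inverseˡ)
open import Data.Fin.Subset using (Subset; ∣_∣) renaming (_∈_ to _∈ₛ_)
open import Data.Vec using (Vec; []; _∷_; _∷ʳ_; _++_; lookup; tabulate; head; tail; last; map; replicate)
-- Membership in a subset is  _[_]=_  on its characteristic vector.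
open import Data.Vec using () renaming (here to inₛ-here; there to inₛ-there)
open import Data.Vec.Properties
  using (lookup∘tabulate; tabulate∘lookup; tabulate-cong; tabulate-∘; lookup-map; map-∷ʳ; lookup-++ˡ)
open import Data.Vec.Membership.Propositional using (_∈_; _∉_)
open import Data.Vec.Membership.Propositional.Properties using (∈-lookup; ∈-map⁺; fromAny)
open import Data.Vec.Relation.Unary.Any using (here; there)
import Data.Vec.Relation.Unary.Any as Any
open import Data.Vec.Relation.Unary.Any.Properties using (lookup-index; map⁻)
open import Data.Vec.Relation.Unary.All using (All; []; _∷_)
import Data.Vec.Relation.Unary.All as All
import Data.Vec.Relation.Unary.All.Properties as AllP
open import Data.Product using (Σ; ∃-syntax; _×_; _,_; proj₁; proj₂)
open import Data.Sum using (_⊎_; inj₁; inj₂)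
import Data.Sum as Sum
open import Data.Unit using (tt)
open import Data.Empty using (⊥-elim)
open import Function.Definitions using (Injective)
open import Function.Bundles using (_⇔_; mk⇔; Equivalence)
open import Function.Construct.Identity using (⇔-id)
open import Function.Construct.Composition using (_⇔-∘_)
open import Function.Construct.Symmetry using (⇔-sym)
open import Relation.Nullary using (¬_; yes; no; contradiction)
open import Relation.Binary.PropositionalEquality
  using (_≡_; _≢_; refl; sym; trans; cong; cong₂; subst; subst₂; module ≡-Reasoning)
open ≡-Reasoning

module _ {X : Set} where

  ∈⇒lookup : ∀ {k} {x : X} {w : Vec X k} → x ∈ w → ∃[ i ] lookup w i ≡ x
  ∈⇒lookup x∈w = Any.index x∈w , sym (lookup-index x∈w)

  lookup⇒∈ : ∀ {k} {x : X} (w : Vec X k) (i : Fin k) → lookup w i ≡ x → x ∈ w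
  lookup⇒∈ w i refl = ∈-lookup i w

  lookup-ext : ∀ {k} (a b : Vec X k) → (∀ i → lookup a i ≡ lookup b i) → a ≡ b
  lookup-ext a b a≗b = begin
    a                   ≡⟨ tabulate∘lookup a ⟨
    tabulate (lookup a) ≡⟨ tabulate-cong a≗b ⟩
    tabulate (lookup b) ≡⟨ tabulate∘lookup b ⟩
    b                   ∎

  head∉tail : ∀ {k} {x : X} {xs : Vec X k} → Injective _≡_ _≡_ (lookup (x ∷ xs)) → x ∉ xs
  head∉tail distinct x∈xs with ∈⇒lookup x∈xs
  ... | i , eq = contradiction (distinct {suc i} {zero} eq) λ ()

  lookup-∷ʳ-inject₁ : ∀ {k} (xs : Vec X k) (y : X) (i : Fin k) →
                      lookup (xs ∷ʳ y) (inject₁ i) ≡ lookup xs i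
  lookup-∷ʳ-inject₁ (x ∷ xs) y zero    = refl
  lookup-∷ʳ-inject₁ (x ∷ xs) y (suc i) = lookup-∷ʳ-inject₁ xs y i

  lookup-∷ʳ-last : ∀ {k} (xs : Vec X k) (y : X) → lookup (xs ∷ʳ y) (fromℕ k) ≡ y
  lookup-∷ʳ-last []       y = refl
  lookup-∷ʳ-last (x ∷ xs) y = lookup-∷ʳ-last xs y

  ∈-∷ʳ⁻ : ∀ {k} {z : X} (xs : Vec X k) (y : X) → z ∈ xs ∷ʳ y → z ∈ xs ⊎ z ≡ y
  ∈-∷ʳ⁻ []       y (here z≡y)  = inj₂ z≡y
  ∈-∷ʳ⁻ (x ∷ xs) y (here z≡x)  = inj₁ (here z≡x)
  ∈-∷ʳ⁻ (x ∷ xs) y (there z∈) = Sum.map₁ there (∈-∷ʳ⁻ xs y z∈)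

  lookup-shift-inject₁ : ∀ {k} (w : Vec X (suc k)) (y : X) (i : Fin k) →
                         lookup (shift w y) (inject₁ i) ≡ lookup w (suc i)
  lookup-shift-inject₁ (x ∷ xs) y i = lookup-∷ʳ-inject₁ xs y i

  lookup-shift-last : ∀ {k} (w : Vec X (suc k)) (y : X) → lookup (shift w y) (fromℕ k) ≡ y
  lookup-shift-last (x ∷ xs) y = lookup-∷ʳ-last xs y

  head∉shift : ∀ {k} {z : X} (w : Vec X (suc k)) → Injective _≡_ _≡_ (lookup w) →
               z ≢ lookup w zero → lookup w zero ∉ shift w z
  head∉shift (x ∷ xs) distinct z≢x x∈ with ∈-∷ʳ⁻ xs _ x∈
  ... | inj₁ x∈xs = head∉tail distinct x∈xs
  ... | inj₂ x≡z  = z≢x (sym x≡z)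

  lookup-permute : ∀ {k} (π : Permutation′ k) (w : Vec X k) (i : Fin k) →
                   lookup (permute π w) i ≡ lookup w (π ⟨$⟩ʳ i)
  lookup-permute π w = lookup∘tabulate _

  ∈-permute : ∀ {k} {z : X} (π : Permutation′ k) (w : Vec X k) → z ∈ permute π w ⇔ z ∈ w
  ∈-permute {z = z} π w = mk⇔ to from
    where
    to : z ∈ permute π w → z ∈ w
    to z∈ with ∈⇒lookup z∈
    ... | i , eq = lookup⇒∈ w (π ⟨$⟩ʳ i) (trans (sym (lookup-permute π w i)) eq)
    from : z ∈ w → z ∈ permute π w
    from z∈ with ∈⇒lookup z∈
    ... | j , eq = lookup⇒∈ (permute π w) (π ⟨$⟩ˡ j)
                     (trans (lookup-permute π w _) (trans (cong (lookup w) (inverseʳ π)) eq))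

  permute-distinct : ∀ {k} (π : Permutation′ k) (w : Vec X k) →
                     Injective _≡_ _≡_ (lookup w) → Injective _≡_ _≡_ (lookup (permute π w))
  permute-distinct π w distinct {i} {j} eq = begin
    i                 ≡⟨ inverseˡ π ⟨
    π ⟨$⟩ˡ (π ⟨$⟩ʳ i) ≡⟨ cong (π ⟨$⟩ˡ_) (distinct (begin
      lookup w (π ⟨$⟩ʳ i)    ≡⟨ lookup-permute π w i ⟨
      lookup (permute π w) i ≡⟨ eq ⟩
      lookup (permute π w) j ≡⟨ lookup-permute π w j ⟩
      lookup w (π ⟨$⟩ʳ j)    ∎)) ⟩
    π ⟨$⟩ˡ (π ⟨$⟩ʳ j) ≡⟨ inverseˡ π ⟩
    j                 ∎

module _ {X Y : Set} (f : X → Y) where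

  map-shift : ∀ {k} (w : Vec X k) (y : X) → map f (shift w y) ≡ shift (map f w) (f y)
  map-shift []       y = refl
  map-shift (x ∷ xs) y = map-∷ʳ f y xs

  map-permute : ∀ {k} (π : Permutation′ k) (w : Vec X k) → map f (permute π w) ≡ permute π (map f w)
  map-permute π w = begin
    map f (tabulate (λ i → lookup w (π ⟨$⟩ʳ i)))
      ≡⟨ tabulate-∘ f _ ⟨
    tabulate (λ i → f (lookup w (π ⟨$⟩ʳ i)))
      ≡⟨ tabulate-cong (λ i → lookup-map (π ⟨$⟩ʳ i) f w) ⟨
    permute π (map f w)
      ∎

  last-map : ∀ {k} (s : Vec X (suc k)) → last (map f s) ≡ f (last s)
  last-map (x ∷ [])    = refl
  last-map (x ∷ y ∷ s) = last-map (y ∷ s)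

sameAlphabet-refl : ∀ {m n} (u : Word m n) → SameAlphabet u u
sameAlphabet-refl u x = ⇔-id _

sameAlphabet-trans : ∀ {m n} {u v w : Word m n} → SameAlphabet u v → SameAlphabet v w → SameAlphabet u w
sameAlphabet-trans u~v v~w x = v~w x ⇔-∘ u~v x

sameAlphabet-permute : ∀ {m n} (π : Permutation′ n) (w : Word m n) → SameAlphabet w (permute π w)
sameAlphabet-permute π w x = ⇔-sym (∈-permute π w)

-- Letter drift.  In G_m(Π) with Π shift restricted, words have length N = n + 1
-- and every arc moves each letter at most one position to the left.

module LetterDrift {n : ℕ} (Π : PermSet (suc n)) (m : ℕ) (SR : ShiftRestricted Π) where

  W : Set
  W = Word m (suc n)

  arc-stepBack : ∀ {w w' : W} → Arc Π m w w' → (i : Fin (suc n)) → toℕ i < n →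
                 ∃[ j ] toℕ j ≤ suc (toℕ i) × lookup w j ≡ lookup w' i
  arc-stepBack {x ∷ xs} (_ , _ , inj₁ (y , _ , refl)) i i<n with view i
  ... | ‵fromℕ = contradiction (subst (_< n) (toℕ-fromℕ n) i<n) (n≮n n)
  ... | ‵inject₁ i′ =
    suc i′ , ≤-reflexive (cong suc (sym (toℕ-inject₁ i′))) , sym (lookup-∷ʳ-inject₁ xs y i′)
  arc-stepBack {w} (_ , _ , inj₂ (π , π∈Π , refl)) i _ =
    π ⟨$⟩ʳ i , SR π π∈Π i , sym (lookup-permute π w i)

  arc-stepForward : ∀ {w w' : W} → Arc Π m w w' → (p : Fin n) →
                    ∃[ j ] toℕ p ≤ toℕ j × lookup w' j ≡ lookup w (suc p)
  arc-stepForward {w} (_ , _ , inj₁ (y , _ , refl)) p =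
    inject₁ p , ≤-reflexive (sym (toℕ-inject₁ p)) , lookup-shift-inject₁ w y p
  arc-stepForward {w} (_ , _ , inj₂ (π , π∈Π , refl)) p =
    j , ≤-pred (subst (λ q → toℕ q ≤ suc (toℕ j)) (inverseʳ π) (SR π π∈Π j)) ,
    trans (lookup-permute π w j) (cong (lookup w) (inverseʳ π))
    where
    j : Fin (suc n)
    j = π ⟨$⟩ˡ suc p

  arc-newLetter : ∀ {w w' : W} {z} → Arc Π m w w' → z ∈ w' → z ∉ w → w' ≡ shift w z
  arc-newLetter {x ∷ xs} (_ , _ , inj₁ (y , _ , refl)) z∈w' z∉w with ∈-∷ʳ⁻ xs y z∈w'
  ... | inj₁ z∈xs = contradiction (there z∈xs) z∉w
  ... | inj₂ refl = refl
  arc-newLetter {w} (_ , _ , inj₂ (π , _ , refl)) z∈w' z∉w =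
    contradiction (Equivalence.to (∈-permute π w) z∈w') z∉w

  traceBack : ∀ {k} (s : Vec W (suc k)) → Chain (Arc Π m) s → (q : Fin (suc n)) → k + toℕ q < suc n →
              ∃[ p ] toℕ p ≤ k + toℕ q × lookup (head s) p ≡ lookup (last s) q
  traceBack {zero}  (w ∷ [])      _             q _     = q , ≤-refl , refl
  traceBack {suc k} (w ∷ w′ ∷ s) (arc , chain) q bound
    with traceBack (w′ ∷ s) chain q (<⇒≤ bound)
  ... | p′ , p′≤ , eq′ with arc-stepBack arc p′ (≤-<-trans p′≤ (≤-pred bound))
  ... | p , p≤ , eq = p , ≤-trans p≤ (s≤s p′≤) , trans eq eq′

  persist : ∀ {k} (s : Vec W (suc k)) → Chain (Arc Π m) s → (p : Fin (suc n)) → k ≤ toℕ p →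
            lookup (head s) p ∈ last s
  persist {zero}  (w ∷ [])      _             p       _         = ∈-lookup p w
  persist {suc k} (w ∷ w′ ∷ s) _             zero    ()
  persist {suc k} (w ∷ w′ ∷ s) (arc , chain) (suc p) (s≤s k≤p) with arc-stepForward arc p
  ... | j , p≤j , eq = subst (_∈ last (w′ ∷ s)) eq (persist (w′ ∷ s) chain j (≤-trans k≤p p≤j))

-- From b one returns to a either along two different walks of length k or
-- along a shorter walk.  (The hypothesis of the theorem asks this of every
-- arc a → b of Γ_n, with k the word length.)
ReturnWalks : {X : Set} (V : X → Set) (R : X → X → Set) (k : ℕ) → X → X → Set
ReturnWalks V R k b a =
  (Σ (Vec _ (suc k)) λ s → Σ (Vec _ (suc k)) λ t → IsWalk V R k b a s × IsWalk V R k b a t × s ≢ t)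
  ⊎ (Σ ℕ λ j → j < k × Walk V R j b a)

module ShiftArc {n : ℕ} (Π : PermSet (suc n)) (m : ℕ) (SR : ShiftRestricted Π)
  (u : Word m (suc n)) (y : Fin m) (u-vertex : IsVertex u) (y∉u : y ∉ u) where

  open LetterDrift Π m SR

  y≢u₀ : y ≢ lookup u zero
  y≢u₀ y≡u₀ = y∉u (lookup⇒∈ u zero (sym y≡u₀))

  -- The first letter u₀ of u is missing from shift u y; on the way back to u it
  -- can only enter at the last position and then needs N steps to reach the front.
  noShortReturn : ∀ k → k < suc n → ¬ Walk IsVertex (Arc Π m) k (shift u y) u
  noShortReturn k k<N ((w ∷ s) , refl , last≡u , _ , chain)
    with traceBack (w ∷ s) chain zero (subst (_< suc n) (sym (+-identityʳ k)) k<N)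
  ... | p , _ , eq =
    head∉shift u u-vertex y≢u₀ (lookup⇒∈ w p (trans eq (cong (λ x → lookup x zero) last≡u)))

  letter : ∀ {t} → t < suc n → Fin m
  letter t<N = lookup u (fromℕ< t<N)

  Aligned : ℕ → W → Set
  Aligned t w = ∀ i j → toℕ j ≡ toℕ i + t → lookup w i ≡ lookup u j

  Missing : ℕ → W → Set
  Missing t w = (t<N : t < suc n) → letter t<N ∉ w

  aligned-shift : ∀ {t} {w : W} z → Aligned t w → Aligned (suc t) (shift w z)
  aligned-shift {t} {w} z aligned i j j≡ with view i
  ... | ‵fromℕ = ⊥-elim (m+1+n≰m n (≤-pred (subst (_< suc n) j≡N+t (toℕ<n j))))
    where
    j≡N+t : toℕ j ≡ n + suc t
    j≡N+t = trans j≡ (cong (_+ suc t) (toℕ-fromℕ n))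
  ... | ‵inject₁ i′ = trans (lookup-shift-inject₁ w z i′) (aligned (suc i′) j (begin
    toℕ j                     ≡⟨ j≡ ⟩
    toℕ (inject₁ i′) + suc t ≡⟨ cong (_+ suc t) (toℕ-inject₁ i′) ⟩
    toℕ i′ + suc t           ≡⟨ +-suc (toℕ i′) t ⟩
    suc (toℕ i′) + t         ∎))

  aligned-start : Aligned 1 (shift u y)
  aligned-start = aligned-shift {w = u} y λ i j j≡ →
    cong (lookup u) (toℕ-injective (sym (trans j≡ (+-identityʳ _))))

  missing-start : Missing 0 (shift u y)
  missing-start _ = head∉shift u u-vertex y≢u₀

  missing-shift : ∀ {t} {w : W} → IsVertex w → Aligned (suc t) w →
                  (t<N : t < suc n) → Missing (suc t) (shift w (letter t<N))
  missing-shift {t} {w} w-vertex aligned t<N st<N =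
    subst (_∉ shift w (letter t<N)) w₀≡ (head∉shift w w-vertex letter≢w₀)
    where
    w₀≡ : lookup w zero ≡ letter st<N
    w₀≡ = aligned zero (fromℕ< st<N) (toℕ-fromℕ< st<N)
    letter≢w₀ : letter t<N ≢ lookup w zero
    letter≢w₀ eq = 1+n≢n (begin
      suc t                  ≡⟨ toℕ-fromℕ< st<N ⟨
      toℕ (fromℕ< st<N)      ≡⟨ cong toℕ (u-vertex (trans (sym w₀≡) (sym eq))) ⟩
      toℕ (fromℕ< t<N)       ≡⟨ toℕ-fromℕ< t<N ⟩
      t                      ∎)

  t+1+r≡N⇒t<N : ∀ {r t} → t + suc r ≡ suc n → t < suc n
  t+1+r≡N⇒t<N {r} {t} len = subst (t <_) len (m<m+n t (s≤s z≤n))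

  forcedShift : ∀ {r t} {w w′ : W} (rest : Vec W r) (len : t + suc r ≡ suc n) → Missing t w →
                Arc Π m w w′ → Chain (Arc Π m) (w′ ∷ rest) → last (w′ ∷ rest) ≡ u →
                w′ ≡ shift w (letter (t+1+r≡N⇒t<N len))
  forcedShift {r} {t} {w} {w′} rest len missing arc chain last≡u
    with traceBack (w′ ∷ rest) chain q (≤-reflexive bound)
    where
    q : Fin (suc n)
    q = fromℕ< (t+1+r≡N⇒t<N len)
    bound : suc (r + toℕ q) ≡ suc n
    bound = begin
      suc (r + toℕ q) ≡⟨ cong (λ x → suc (r + x)) (toℕ-fromℕ< (t+1+r≡N⇒t<N len)) ⟩
      suc (r + t)     ≡⟨ cong suc (+-comm r t) ⟩
      suc (t + r)     ≡⟨ +-suc t r ⟨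
      t + suc r       ≡⟨ len ⟩
      suc n           ∎
  ... | p , _ , eq = arc-newLetter arc
    (lookup⇒∈ w′ p (trans eq (cong (λ x → lookup x (fromℕ< (t+1+r≡N⇒t<N len))) last≡u)))
    (missing (t+1+r≡N⇒t<N len))

  uniqueFrom : ∀ r t (w : W) (ss ts : Vec W r) → t + r ≡ suc n → IsVertex w →
               Aligned (suc t) w → Missing t w →
               Chain (Arc Π m) (w ∷ ss) → Chain (Arc Π m) (w ∷ ts) →
               last (w ∷ ss) ≡ u → last (w ∷ ts) ≡ u → ss ≡ ts
  uniqueFrom zero t w [] [] _ _ _ _ _ _ _ _ = refl
  uniqueFrom (suc r) t w (w₁ ∷ ss) (w₁′ ∷ ts) len w-vertex aligned missing
             (arc , chain) (arc′ , chain′) ls ls′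
    with forcedShift ss len missing arc chain ls | forcedShift ts len missing arc′ chain′ ls′
  ... | refl | refl =
    cong (z ∷_) (uniqueFrom r (suc t) z ss ts (trans (sym (+-suc t r)) len) (proj₁ (proj₂ arc))
                   (aligned-shift {w = w} _ aligned) (missing-shift {w = w} w-vertex aligned (t+1+r≡N⇒t<N len))
                   chain chain′ ls ls′)
    where
    z : W
    z = shift w (letter (t+1+r≡N⇒t<N len))

  uniqueReturn : ∀ s t → IsWalk IsVertex (Arc Π m) (suc n) (shift u y) u s →
                 IsWalk IsVertex (Arc Π m) (suc n) (shift u y) u t → s ≡ t
  uniqueReturn (w ∷ ss) (w′ ∷ ts) (refl , ls , w-vertex ∷ _ , chain) (refl , ls′ , _ , chain′) =
    cong (w ∷_) (uniqueFrom (suc n) 0 w ss ts refl w-vertex aligned-start missing-start chain chain′ ls ls′)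

  shift-noReturn : ¬ ReturnWalks IsVertex (Arc Π m) (suc n) (shift u y) u
  shift-noReturn (inj₁ (s , t , s-walk , t-walk , s≢t)) = s≢t (uniqueReturn s t s-walk t-walk)
  shift-noReturn (inj₂ (k , k<N , walk))              = noShortReturn k k<N walk

module WalkTransport {X Y : Set} {V : X → Set} {R : X → X → Set} {V′ : Y → Set} {R′ : Y → Y → Set}
  (f : X → Y) (f-vertex : ∀ {x} → V x → V′ (f x)) (f-arc : ∀ {x x′} → R x x′ → R′ (f x) (f x′))
  (f-injective : ∀ {x x′} → V x → V x′ → f x ≡ f x′ → x ≡ x′) where

  chain-map : ∀ {k} (s : Vec X (suc k)) → Chain R s → Chain R′ (map f s)
  chain-map (x ∷ [])      _             = tt
  chain-map (x ∷ x′ ∷ s) (arc , chain) = f-arc arc , chain-map (x′ ∷ s) chain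

  walk-map : ∀ {k a b} (s : Vec X (suc k)) → IsWalk V R k a b s → IsWalk V′ R′ k (f a) (f b) (map f s)
  walk-map (x ∷ s) (refl , last≡b , vertices , chain) =
    refl , trans (last-map f (x ∷ s)) (cong f last≡b) , AllP.map⁺ (All.map f-vertex vertices) ,
    chain-map (x ∷ s) chain

  map-injective : ∀ {k} (s t : Vec X k) → All V s → All V t → map f s ≡ map f t → s ≡ t
  map-injective []      []      _            _            _  = refl
  map-injective (x ∷ s) (x′ ∷ t) (vx ∷ vs) (vx′ ∷ vt) eq =
    cong₂ _∷_ (f-injective vx vx′ (cong head eq)) (map-injective s t vs vt (cong tail eq))

  returnWalks-map : ∀ {k a b} → ReturnWalks V R k b a → ReturnWalks V′ R′ k (f b) (f a)
  returnWalks-map (inj₁ (s , t , s-walk@(_ , _ , s-vertices , _) , t-walk@(_ , _ , t-vertices , _) , s≢t)) =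
    inj₁ (map f s , map f t , walk-map s s-walk , walk-map t t-walk ,
          λ eq → s≢t (map-injective s t s-vertices t-vertices eq))
  returnWalks-map (inj₂ (j , j<k , s , s-walk)) = inj₂ (j , j<k , map f s , walk-map s s-walk)

record Enumeration {k : ℕ} (A : Subset k) (N : ℕ) : Set where
  field
    list     : Vec (Fin k) N
    distinct : Injective _≡_ _≡_ (lookup list)
    sound    : ∀ {x} → x ∈ list → x ∈ₛ A
    complete : ∀ {x} → x ∈ₛ A → x ∈ list

elements : ∀ {k} (A : Subset k) → Vec (Fin k) ∣ A ∣
elements []          = []
elements (true ∷ A)  = zero ∷ map suc (elements A)
elements (false ∷ A) = map suc (elements A)

elements-sound : ∀ {k} (A : Subset k) {x} → x ∈ elements A → x ∈ₛ A
elements-sound (true ∷ A) (here refl) = inₛ-here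
elements-sound (true ∷ A) (there x∈) with fromAny (map⁻ x∈)
... | x′ , x′∈ , refl = inₛ-there (elements-sound A x′∈)
elements-sound (false ∷ A) x∈ with fromAny (map⁻ x∈)
... | x′ , x′∈ , refl = inₛ-there (elements-sound A x′∈)

elements-complete : ∀ {k} (A : Subset k) {x} → x ∈ₛ A → x ∈ elements A
elements-complete (true ∷ A)  inₛ-here       = here refl
elements-complete (true ∷ A)  (inₛ-there x∈) = there (∈-map⁺ suc (elements-complete A x∈))
elements-complete (false ∷ A) (inₛ-there x∈) = ∈-map⁺ suc (elements-complete A x∈)

elements-distinct : ∀ {k} (A : Subset k) → Injective _≡_ _≡_ (lookup (elements A))

map-suc-distinct : ∀ {k} (A : Subset k) → Injective _≡_ _≡_ (lookup (map suc (elements A)))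
map-suc-distinct A {i} {j} eq = elements-distinct A (suc-injective (begin
  suc (lookup (elements A) i)     ≡⟨ lookup-map i suc (elements A) ⟨
  lookup (map suc (elements A)) i ≡⟨ eq ⟩
  lookup (map suc (elements A)) j ≡⟨ lookup-map j suc (elements A) ⟩
  suc (lookup (elements A) j)     ∎))

elements-distinct (true ∷ A) {zero}  {zero}  _  = refl
elements-distinct (true ∷ A) {zero}  {suc j} eq =
  contradiction (trans eq (lookup-map j suc (elements A))) λ ()
elements-distinct (true ∷ A) {suc i} {zero}  eq =
  contradiction (trans (sym eq) (lookup-map i suc (elements A))) λ ()
elements-distinct (true ∷ A) {suc i} {suc j} eq = cong suc (map-suc-distinct A eq)
elements-distinct (false ∷ A)                eq = map-suc-distinct A eq

enumerate : ∀ {k N} (A : Subset k) → ∣ A ∣ ≡ N → Enumeration A N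
enumerate A refl = record
  { list = elements A ; distinct = elements-distinct A
  ; sound = elements-sound A ; complete = elements-complete A }

-- Listing A as e, the
-- map sending the i-th letter of e to the i-th letter of a embeds Γ_n into
-- G_m, sending e to a and the permutation arc e → π e to a → π a.

module Relabel {n m : ℕ} (Π : PermSet (suc n)) (A : Subset m) (E : Enumeration A (suc n))
  (a : Word m (suc n)) (a-vertex : IsVertex a) where

  open Enumeration E renaming (list to e)
  open import Data.Vec.Membership.DecPropositional (_≟_ {m}) using (_∈?_)

  relabel : Fin m → Fin m
  relabel x with x ∈? e
  ... | yes x∈e = lookup a (Any.index x∈e)
  ... | no _    = x

  relabel-e : ∀ i → relabel (lookup e i) ≡ lookup a i
  relabel-e i with lookup e i ∈? e
  ... | yes eᵢ∈e = cong (lookup a) (distinct (sym (lookup-index eᵢ∈e)))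
  ... | no eᵢ∉e  = contradiction (∈-lookup i e) eᵢ∉e

  relabel-injective : ∀ {x x′} → x ∈ₛ A → x′ ∈ₛ A → relabel x ≡ relabel x′ → x ≡ x′
  relabel-injective x∈A x′∈A eq with ∈⇒lookup (complete x∈A) | ∈⇒lookup (complete x′∈A)
  ... | i , refl | i′ , refl = cong (lookup e) (a-vertex (begin
    lookup a i            ≡⟨ relabel-e i ⟨
    relabel (lookup e i)  ≡⟨ eq ⟩
    relabel (lookup e i′) ≡⟨ relabel-e i′ ⟩
    lookup a i′           ∎))

  relabel-vertex : ∀ {w : Word m (suc n)} → InΓ A w → IsVertex (map relabel w)
  relabel-vertex {w} (w-vertex , w⊆A) {i} {j} eq = w-vertex (relabel-injective
    (AllP.lookup⁺ w⊆A i) (AllP.lookup⁺ w⊆A j)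
    (trans (sym (lookup-map i relabel w)) (trans eq (lookup-map j relabel w))))

  relabel-arc : ∀ {w w′ : Word m (suc n)} → ArcΓ Π m A w w′ → Arc Π m (map relabel w) (map relabel w′)
  relabel-arc {w} (wΓ , w′Γ , _ , _ , inj₂ (π , π∈Π , refl)) =
    relabel-vertex wΓ , relabel-vertex w′Γ , inj₂ (π , π∈Π , map-permute relabel π w)
  relabel-arc {w} (wΓ , w′Γ , _ , _ , inj₁ (y , y∉w , refl)) =
    relabel-vertex wΓ , relabel-vertex w′Γ , inj₁ (relabel y , new , map-shift relabel w y)
    where
    y∈A : y ∈ₛ A
    y∈A = subst (_∈ₛ A) (lookup-shift-last w y) (AllP.lookup⁺ (proj₂ w′Γ) (fromℕ n))
    new : relabel y ∉ map relabel w
    new ry∈ with fromAny (map⁻ ry∈)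
    ... | z , z∈w , ry≡rz =
      y∉w (subst (_∈ w) (relabel-injective (All.lookup (proj₂ wΓ) z∈w) y∈A (sym ry≡rz)) z∈w)

  relabel-word-injective : ∀ {w w′ : Word m (suc n)} → InΓ A w → InΓ A w′ →
                           map relabel w ≡ map relabel w′ → w ≡ w′
  relabel-word-injective {w} {w′} (_ , w⊆A) (_ , w′⊆A) eq = lookup-ext w w′ λ i →
    relabel-injective (AllP.lookup⁺ w⊆A i) (AllP.lookup⁺ w′⊆A i) (begin
      relabel (lookup w i)      ≡⟨ lookup-map i relabel w ⟨
      lookup (map relabel w) i  ≡⟨ cong (λ v → lookup v i) eq ⟩
      lookup (map relabel w′) i ≡⟨ lookup-map i relabel w′ ⟩
      relabel (lookup w′ i)     ∎)

  open WalkTransport {V = InΓ A} {R = ArcΓ Π m A} {V′ = IsVertex} {R′ = Arc Π m}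
         (map relabel) relabel-vertex relabel-arc relabel-word-injective

  relabel-list : map relabel e ≡ a
  relabel-list = lookup-ext _ _ λ i → trans (lookup-map i relabel e) (relabel-e i)

  e-in-Γ : InΓ A e
  e-in-Γ = distinct , AllP.lookup⁻ λ i → sound (∈-lookup i e)

  permArc-returns : WalkHypothesis Π m A → ∀ {π} → Π π →
                    ReturnWalks IsVertex (Arc Π m) (suc n) (permute π a) a
  permArc-returns hyp {π} π∈Π =
    subst₂ (ReturnWalks IsVertex (Arc Π m) (suc n)) relabel-πe relabel-list
      (returnWalks-map (hyp e (permute π e) e-in-Γ πe-in-Γ
        (e-in-Γ , πe-in-Γ , distinct , proj₁ πe-in-Γ , inj₂ (π , π∈Π , refl))))
    where
    πe-in-Γ : InΓ A (permute π e)
    πe-in-Γ = permute-distinct π e distinct , AllP.tabulate⁺ λ i → sound (∈-lookup (π ⟨$⟩ʳ i) e)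
    relabel-πe : map relabel (permute π e) ≡ permute π a
    relabel-πe = trans (map-permute relabel π e) (cong (permute π) relabel-list)

-- An automorphism maps a permutation arc a → π a having return walks to a
-- permutation arc: were the image a shift arc, transporting the return walks
-- along the automorphism would contradict `shift-noReturn`.
automorphism-permArc : ∀ {n m} {Π : PermSet (suc n)} {φ : Word m (suc n) → Word m (suc n)} →
  ShiftRestricted Π → IsAutomorphism Π m φ → ∀ {a π} → IsVertex a → Π π →
  ReturnWalks IsVertex (Arc Π m) (suc n) (permute π a) a → SameAlphabet (φ a) (φ (permute π a))
automorphism-permArc {n} {m} {Π} {φ} SR (φ-vertex , φ-injective , _ , φ-arc) {a} {π} a-vertex π∈Π returns =
  image-alphabet (Equivalence.to (φ-arc a (permute π a) a-vertex πa-vertex)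
                                 (a-vertex , πa-vertex , inj₂ (π , π∈Π , refl)))
  where
  πa-vertex : IsVertex (permute π a)
  πa-vertex = permute-distinct π a a-vertex

  open WalkTransport {V = IsVertex} {R = Arc Π m} {V′ = IsVertex} {R′ = Arc Π m} φ (φ-vertex _)
         (λ arc → Equivalence.to (φ-arc _ _ (proj₁ arc) (proj₁ (proj₂ arc))) arc)
         (φ-injective _ _)

  image-alphabet : Arc Π m (φ a) (φ (permute π a)) → SameAlphabet (φ a) (φ (permute π a))
  image-alphabet (_ , _ , inj₂ (π′ , _ , eq)) =
    subst (SameAlphabet (φ a)) (sym eq) (sameAlphabet-permute π′ (φ a))
  image-alphabet (_ , _ , inj₁ (y , y∉φa , eq)) =
    ⊥-elim (ShiftArc.shift-noReturn Π m SR (φ a) y (φ-vertex a a-vertex) y∉φa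
              (subst (λ b → ReturnWalks IsVertex (Arc Π m) (suc n) b (φ a)) eq (returnWalks-map returns)))

data PermReach {N : ℕ} (Π : PermSet N) {X : Set} : Vec X N → Vec X N → Set where
  done : ∀ {x} → PermReach Π x x
  step : ∀ {x y} (π : Permutation′ N) → Π π → PermReach Π (permute π x) y → PermReach Π x y

permReach-map : ∀ {N} {Π : PermSet N} {X Y : Set} (f : X → Y) {x y : Vec X N} →
                PermReach Π x y → PermReach Π (map f x) (map f y)
permReach-map f done                     = done
permReach-map f {x} (step π π∈Π x→y) =
  step π π∈Π (subst (λ z → PermReach _ z _) (map-permute f π x) (permReach-map f x→y))

-- A walk of length ≤ N that brings in no letter outside its first word
-- consists of permutation arcs: a letter inserted by a shift at the last
-- position would survive to the end of the walk.
shortWalk⇒permReach : ∀ {n m} {Π : PermSet (suc n)} → ShiftRestricted Π →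
  ∀ {k} (s : Vec (Word m (suc n)) (suc k)) → k ≤ suc n → Chain (Arc Π m) s →
  (∀ {x} → x ∈ last s → x ∈ head s) → PermReach Π (head s) (last s)
shortWalk⇒permReach SR {zero} (w ∷ []) _ _ _ = done
shortWalk⇒permReach SR {suc k} (w ∷ _ ∷ s) (s≤s k≤n)
                    ((_ , _ , inj₂ (π , π∈Π , refl)) , chain) last⊆w =
  step π π∈Π (shortWalk⇒permReach SR (permute π w ∷ s) (m≤n⇒m≤1+n k≤n) chain
                (λ x∈ → Equivalence.from (∈-permute π w) (last⊆w x∈)))
shortWalk⇒permReach {n} {m} {Π} SR {suc k} (w ∷ _ ∷ s) (s≤s k≤n)
                    ((_ , _ , inj₁ (y , y∉w , refl)) , chain) last⊆w =
  contradiction (last⊆w y∈last) y∉w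
  where
  open LetterDrift Π m SR
  y∈last : y ∈ last (shift w y ∷ s)
  y∈last = subst (_∈ last (shift w y ∷ s)) (lookup-shift-last w y)
             (persist (shift w y ∷ s) chain (fromℕ n) (subst (k ≤_) (sym (toℕ-fromℕ n)) k≤n))

-- Position words for two vertices u, v of G_m with the same alphabet:
-- c = 0 1 … n lists the positions of u, d lists the positions in u of the
-- letters of v.  Both are vertices of G_{4N}, and reading positions through
-- u turns c into u and d into v.

module PositionWords {n m : ℕ} (u v : Word m (suc n)) (u-vertex : IsVertex u) (v-vertex : IsVertex v)
  (u~v : SameAlphabet u v) where

  N : ℕ
  N = suc n

  index : Fin N → Fin (4 * N)
  index i = i ↑ˡ (3 * N)

  pos : Fin N → Fin N
  pos i = proj₁ (∈⇒lookup (Equivalence.from (u~v (lookup v i)) (∈-lookup i v)))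

  pos-spec : ∀ i → lookup u (pos i) ≡ lookup v i
  pos-spec i = proj₂ (∈⇒lookup (Equivalence.from (u~v (lookup v i)) (∈-lookup i v)))

  c d : Word (4 * N) N
  c = tabulate index
  d = tabulate (λ i → index (pos i))

  c-at : ∀ i → lookup c i ≡ index i
  c-at = lookup∘tabulate index

  d-at : ∀ i → lookup d i ≡ index (pos i)
  d-at = lookup∘tabulate (λ i → index (pos i))

  c-vertex : IsVertex c
  c-vertex {i} {j} eq = ↑ˡ-injective (3 * N) i j (trans (sym (c-at i)) (trans eq (c-at j)))

  d-vertex : IsVertex d
  d-vertex {i} {j} eq = v-vertex (begin
    lookup v i       ≡⟨ pos-spec i ⟨
    lookup u (pos i) ≡⟨ cong (lookup u) (↑ˡ-injective (3 * N) (pos i) (pos j) (begin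
      index (pos i)  ≡⟨ d-at i ⟨
      lookup d i     ≡⟨ eq ⟩
      lookup d j     ≡⟨ d-at j ⟩
      index (pos j)  ∎)) ⟩
    lookup u (pos j) ≡⟨ pos-spec j ⟩
    lookup v j       ∎)

  d⊆c : ∀ {x} → x ∈ d → x ∈ c
  d⊆c x∈d with ∈⇒lookup x∈d
  ... | i , eq = lookup⇒∈ c (pos i) (trans (c-at (pos i)) (trans (sym (d-at i)) eq))

  -- Read a position of G_{4N} as the letter of u there (positions beyond N are padding).
  read : Fin (4 * N) → Fin m
  read = lookup (u ++ replicate (3 * N) (lookup u zero))

  read-index : ∀ i → read (index i) ≡ lookup u i
  read-index i = lookup-++ˡ u (replicate (3 * N) (lookup u zero)) i

  read-c : map read c ≡ u
  read-c = lookup-ext _ _ λ i → begin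
    lookup (map read c) i ≡⟨ lookup-map i read c ⟩
    read (lookup c i)     ≡⟨ cong read (c-at i) ⟩
    read (index i)        ≡⟨ read-index i ⟩
    lookup u i            ∎

  read-d : map read d ≡ v
  read-d = lookup-ext _ _ λ i → begin
    lookup (map read d) i ≡⟨ lookup-map i read d ⟩
    read (lookup d i)     ≡⟨ cong read (d-at i) ⟩
    read (index (pos i))  ≡⟨ read-index (pos i) ⟩
    lookup u (pos i)      ≡⟨ pos-spec i ⟩
    lookup v i            ∎

-- In an admissible, shift restricted word graph, vertices with the same
-- alphabet are joined by permutation arcs: the admissible walk from c to d in
-- G_{4N} consists of permutation arcs, and reading it through u joins u to v.
sameAlphabet⇒permReach : ∀ {n m} {Π : PermSet (suc n)} → Admissible Π → ShiftRestricted Π →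
  ∀ {u v : Word m (suc n)} → IsVertex u → IsVertex v → SameAlphabet u v → PermReach Π u v
sameAlphabet⇒permReach {n} {m} {Π} adm SR {u} {v} u-vertex v-vertex u~v =
  joined (proj₁ adm c d c-vertex d-vertex)
  where
  open PositionWords u v u-vertex v-vertex u~v

  joined : (Σ ℕ λ k → k ≤ N × Walk IsVertex (Arc Π (4 * N)) k c d) → PermReach Π u v
  joined (k , k≤N , (_ ∷ s) , refl , last≡d , _ , chain) =
    subst₂ (PermReach Π) read-c read-d (permReach-map read (subst (PermReach Π c) last≡d c→last))
    where
    c→last : PermReach Π c (last (c ∷ s))
    c→last = shortWalk⇒permReach SR (c ∷ s) k≤N chain λ x∈ → d⊆c (subst (_ ∈_) last≡d x∈)

mainTheorem13 : (n : ℕ) → 1 ≤ n → (Π : PermSet n) → Admissible Π → ShiftRestricted Π →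
                  (m : ℕ) → n < m → (A : Subset m) → ∣ A ∣ ≡ n →
                  WalkHypothesis Π m A → AlphabetStable Π m
mainTheorem13 zero () _ _ _ _ _ _ _ _
mainTheorem13 (suc n) _ Π adm SR m _ A |A|≡N hyp (φ , φ-aut , u , v , u-vertex , v-vertex , u~v , φu≁φv) =
  φu≁φv (φ-respects u-vertex (sameAlphabet⇒permReach adm SR u-vertex v-vertex u~v))
  where
  returns : ∀ {a π} → IsVertex a → Π π → ReturnWalks IsVertex (Arc Π m) (suc n) (permute π a) a
  returns {a} a-vertex = Relabel.permArc-returns Π A (enumerate A |A|≡N) a a-vertex hyp

  φ-respects : ∀ {a b} → IsVertex a → PermReach Π a b → SameAlphabet (φ a) (φ b)
  φ-respects {a} _        done                = sameAlphabet-refl (φ a)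
  φ-respects {a} a-vertex (step π π∈Π a→b) =
    sameAlphabet-trans (automorphism-permArc SR φ-aut a-vertex π∈Π (returns a-vertex π∈Π))
                       (φ-respects (permute-distinct π a a-vertex) a→b)
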